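{- Every convex integer pentagon in $\mathbb{R}^2$ contains a point of the lattice $2\mathbb{Z}^2=\{(2u_1,2u_2): u_1,u_2\in\mathbb{Z}\}$.
   Context: A convex polygon is the convex hull of a finite subset of $\mathbb{R}^2$ having nonempty interior; a pentagon is such a polygon with exactly $5$ vertices. It is an integer polygon if all its vertices belong to $\mathbb{Z}^2$. -}

module Defs where

open import Data.Nat using (ℕ; zero; suc)
open import Data.Fin using (Fin; zero; suc)
open import Data.Integer using (ℤ; +_; _+_; _*_; _-_; 0ℤ)
open import Data.Product using (_×_; _,_; Σ; ∃; proj₁; proj₂)
open import Relation.Binary.PropositionalEquality using (_≡_; _≢_)
open import Relation.Nullary using (¬_)
open import Function.Definitions using (Injective)

ℤ² : Set
ℤ² = ℤ × ℤ

sumFin : (n : ℕ) → (Fin n → ℤ) → ℤ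
sumFin zero    f = 0ℤ
sumFin (suc n) f = f zero + sumFin n (λ i → f (suc i))

-- p is a convex combination of the points v i whose weights are given by w
-- (weights are nonnegative rationals, written with a common denominator:
--  nonnegative integers w i, not all zero, with Σ w i · v i = (Σ w i) · p).
IsConvComb : (n : ℕ) → (Fin n → ℤ²) → (Fin n → ℕ) → ℤ² → Set
IsConvComb n v w p =
  (sumFin n (λ i → + w i) ≢ 0ℤ) ×
  (sumFin n (λ i → + w i * proj₁ (v i)) ≡ sumFin n (λ i → + w i) * proj₁ p) ×
  (sumFin n (λ i → + w i * proj₂ (v i)) ≡ sumFin n (λ i → + w i) * proj₂ p)

InHull : (n : ℕ) → (Fin n → ℤ²) → ℤ² → Set
InHull n v p = Σ (Fin n → ℕ) λ w → IsConvComb n v w p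

-- v i is a vertex (extreme point) of conv{v j}: it is not a convex
-- combination of the other points v j, j ≠ i.
IsVertex : (n : ℕ) → (Fin n → ℤ²) → Fin n → Set
IsVertex n v i = ¬ (Σ (Fin n → ℕ) λ w → (w i ≡ 0) × IsConvComb n v w (v i))

cross : ℤ² → ℤ² → ℤ² → ℤ
cross (ax , ay) (bx , by) (cx , cy) = (bx - ax) * (cy - ay) - (by - ay) * (cx - ax)

-- conv{v j} has nonempty interior: the points are not all collinear.
NonemptyInterior : (n : ℕ) → (Fin n → ℤ²) → Set
NonemptyInterior n v = Σ (Fin n) λ i → Σ (Fin n) λ j → Σ (Fin n) λ k → cross (v i) (v j) (v k) ≢ 0ℤ

IsIntegerPentagon : (Fin 5 → ℤ²) → Set
IsIntegerPentagon v = Injective _≡_ _≡_ v × (∀ i → IsVertex 5 v i) × NonemptyInterior 5 v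

In2Z2 : ℤ² → Set
In2Z2 (x , y) = ∃ λ (u : ℤ²) → (x ≡ + 2 * proj₁ u) × (y ≡ + 2 * proj₂ u)

-- Work modulo 2ℤ²: a lattice point has one of four parity classes, 𝟎 being 2ℤ² itself, and the
-- midpoint of two points of one class is again a lattice point of the hull.  Three non-collinear hull points a, a + 2u, a + 2w of one class give an even hull
-- point: either a corner of the parallelogram a, a + u, a + w, a + u + w is even, or one of
-- u, w, u + w is, and a triangle of half the area remains.  Two distinct hull points of one
-- class have, strictly between them, a hull point of another class.
-- If no vertex is even, the five vertices fall into the three odd classes, so either three of
-- them share a class (and are not collinear), or the classes are A, A, B, B, C.  In the latter
-- case the midpoints of the A-pair and of the B-pair, together with the points that the segment
-- descent finds on the sides, always produce an even point or three non-collinear hull points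
-- of one class; vertex extremality is what keeps those points off the relevant lines.

module Submission where

open import Defs
open import Data.Bool using (Bool; true; false; _xor_)
import Data.Bool.Properties as Bool
open import Data.Empty using (⊥; ⊥-elim)
open import Data.Fin using (Fin; zero; suc; punchIn)
import Data.Fin.Properties as FinP
open import Data.Integer as ℤ using (ℤ; +_; -[1+_]; _+_; _*_; _-_; -_; 0ℤ; 1ℤ; ∣_∣)
import Data.Integer.DivMod as DM
import Data.Integer.Properties as ℤP
open import Algebra.Properties.AbelianGroup ℤP.+-0-abelianGroup using () renaming (∙-cancelˡ to +-cancelˡ)
open import Data.Integer.Tactic.RingSolver using (solve-∀)
open import Data.Nat as ℕ using (ℕ; zero; suc)
import Data.Nat.Properties as ℕP
open import Data.Nat.Tactic.RingSolver using () renaming (solve-∀ to ℕ-solve-∀)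
open import Data.Product using (Σ; ∃; _×_; _,_; proj₁; proj₂)
open import Data.Product.Properties using (≡-dec)
open import Data.Sum using (_⊎_; inj₁; inj₂; [_,_]′)
open import Function using (_∘_; id; flip)
open import Function.Definitions using (Injective)
open import Relation.Binary.PropositionalEquality
open import Relation.Nullary using (¬_; Dec; yes; no; ¬?)
open import Relation.Nullary.Decidable using (map′; _×-dec_; _⊎-dec_; _→-dec_; from-yes)

positive-factor : ∀ n {x} → + suc n * x ≡ 0ℤ → x ≡ 0ℤ
positive-factor n {x} e = ℤP.*-cancelˡ-≡ (+ suc n) x 0ℤ (trans e (sym (ℤP.*-zeroʳ (+ suc n))))

sumFin-cong : ∀ n {f g : Fin n → ℤ} → (∀ i → f i ≡ g i) → sumFin n f ≡ sumFin n g
sumFin-cong zero    f≡g = refl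
sumFin-cong (suc n) f≡g = cong₂ _+_ (f≡g zero) (sumFin-cong n (f≡g ∘ suc))

sumFin-linear : ∀ n (A B : ℤ) (f g : Fin n → ℤ) →
  sumFin n (λ i → A * f i + B * g i) ≡ A * sumFin n f + B * sumFin n g
sumFin-linear zero    A B f g = zero-sum A B
  where
  zero-sum : ∀ A B → 0ℤ ≡ A * 0ℤ + B * 0ℤ
  zero-sum = solve-∀
sumFin-linear (suc n) A B f g =
  trans (cong (_+_ (A * f zero + B * g zero)) (sumFin-linear n A B (f ∘ suc) (g ∘ suc)))
        (regroup A B (f zero) (g zero) (sumFin n (f ∘ suc)) (sumFin n (g ∘ suc)))
  where
  regroup : ∀ A B a b F G → A * a + B * b + (A * F + B * G) ≡ A * (a + F) + B * (b + G)
  regroup = solve-∀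

sumFin-weighted : ∀ n (A B : ℤ) (w wp wq g : Fin n → ℤ) → (∀ i → w i ≡ A * wp i + B * wq i) →
  sumFin n (λ i → w i * g i) ≡ A * sumFin n (λ i → wp i * g i) + B * sumFin n (λ i → wq i * g i)
sumFin-weighted n A B w wp wq g w≡ =
  trans (sumFin-cong n λ i → trans (cong (_* g i) (w≡ i)) (distrib A B (wp i) (wq i) (g i)))
        (sumFin-linear n A B (λ i → wp i * g i) (λ i → wq i * g i))
  where
  distrib : ∀ A B x y z → (A * x + B * y) * z ≡ A * (x * z) + B * (y * z)
  distrib = solve-∀

sumFinℕ : ∀ n → (Fin n → ℕ) → ℕ
sumFinℕ zero    w = 0
sumFinℕ (suc n) w = w zero ℕ.+ sumFinℕ n (w ∘ suc)

sumFin-pos : ∀ n (w : Fin n → ℕ) → sumFin n (+_ ∘ w) ≡ + sumFinℕ n w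
sumFin-pos zero    w = refl
sumFin-pos (suc n) w = trans (cong (_+_ (+ w zero)) (sumFin-pos n (w ∘ suc))) (sym (ℤP.pos-+ (w zero) _))

indicator : ∀ {n} → Fin n → Fin n → ℕ
indicator zero    zero    = 1
indicator zero    (suc _) = 0
indicator (suc _) zero    = 0
indicator (suc j) (suc i) = indicator j i

indicator-≢ : ∀ {n} (j i : Fin n) → i ≢ j → indicator j i ≡ 0
indicator-≢ zero    zero    i≢j = ⊥-elim (i≢j refl)
indicator-≢ zero    (suc i) i≢j = refl
indicator-≢ (suc j) zero    i≢j = refl
indicator-≢ (suc j) (suc i) i≢j = indicator-≢ j i (i≢j ∘ cong suc)

sumFin-zero : ∀ n (g : Fin n → ℤ) → sumFin n (λ i → + 0 * g i) ≡ 0ℤ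
sumFin-zero zero    g = refl
sumFin-zero (suc n) g = trans (ℤP.+-identityˡ _) (sumFin-zero n (g ∘ suc))

sumFin-indicator : ∀ n (j : Fin n) (g : Fin n → ℤ) → sumFin n (λ i → + indicator j i * g i) ≡ g j
sumFin-indicator (suc n) zero    g = trans (cong (_+_ (1ℤ * g zero)) (sumFin-zero n (g ∘ suc))) (unit (g zero))
  where
  unit : ∀ x → 1ℤ * x + 0ℤ ≡ x
  unit = solve-∀
sumFin-indicator (suc n) (suc j) g = trans (ℤP.+-identityˡ _) (sumFin-indicator n j (g ∘ suc))

-- Mixing point sets of masses P and Q and centres x and y in the ratio a : b puts the centre
-- at the combination z of x and y.
mixture-centre : ∀ a b P Q x y z → (a + b) * z ≡ a * x + b * y →
  a * Q * (P * x) + b * P * (Q * y) ≡ (a * Q * P + b * P * Q) * z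
mixture-centre a b P Q x y z hz = begin
  a * Q * (P * x) + b * P * (Q * y)  ≡⟨ regroup a b P Q x y ⟩
  P * Q * (a * x + b * y)            ≡⟨ cong (P * Q *_) (sym hz) ⟩
  P * Q * ((a + b) * z)              ≡⟨ reassoc a b P Q z ⟩
  (a * Q * P + b * P * Q) * z        ∎
  where
  open ≡-Reasoning
  regroup : ∀ a b P Q x y → a * Q * (P * x) + b * P * (Q * y) ≡ P * Q * (a * x + b * y)
  regroup = solve-∀
  reassoc : ∀ a b P Q z → P * Q * ((a + b) * z) ≡ (a * Q * P + b * P * Q) * z
  reassoc = solve-∀

record Mean (α β : ℕ) (p q r : ℤ²) : Set where
  constructor mean
  field
    mean₁ : (+ α + + β) * proj₁ r ≡ + α * proj₁ p + + β * proj₁ q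
    mean₂ : (+ α + + β) * proj₂ r ≡ + α * proj₂ p + + β * proj₂ q

InHullWithout : (n : ℕ) → (Fin n → ℤ²) → (Fin n → Set) → ℤ² → Set
InHullWithout n v Z p = Σ (Fin n → ℕ) λ w → (∀ i → Z i → w i ≡ 0) × IsConvComb n v w p

module _ {n : ℕ} (v : Fin n → ℤ²) {Z : Fin n → Set} where

  vertex∈hullWithout : ∀ j → ¬ Z j → InHullWithout n v Z (v j)
  vertex∈hullWithout j j∉Z = indicator j , avoids , total≢0 , coordinate proj₁ , coordinate proj₂
    where
    avoids : ∀ i → Z i → indicator j i ≡ 0
    avoids i i∈Z = indicator-≢ j i λ { refl → j∉Z i∈Z }
    total≡1 : sumFin n (λ i → + indicator j i) ≡ 1ℤ
    total≡1 = trans (sumFin-cong n λ i → sym (ℤP.*-identityʳ _)) (sumFin-indicator n j λ _ → 1ℤ)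
    total≢0 : sumFin n (λ i → + indicator j i) ≢ 0ℤ
    total≢0 e with trans (sym total≡1) e
    ... | ()
    coordinate : (π : ℤ² → ℤ) →
      sumFin n (λ i → + indicator j i * π (v i)) ≡ sumFin n (λ i → + indicator j i) * π (v j)
    coordinate π = trans (sumFin-indicator n j (π ∘ v))
      (trans (sym (ℤP.*-identityˡ _)) (cong (_* π (v j)) (sym total≡1)))

  hullWithout-mean : ∀ {p q r} α β → InHullWithout n v Z p → InHullWithout n v Z q →
    Mean (suc α) β p q r → InHullWithout n v Z r
  hullWithout-mean {p} {q} {r} α β (wp , zp , P≢0 , px , py) (wq , zq , Q≢0 , qx , qy) (mean rx ry) =
    w , avoids , total≢0 , coordinate proj₁ px qx rx , coordinate proj₂ py qy ry
    where
    P = sumFin n (+_ ∘ wp)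
    Q = sumFin n (+_ ∘ wq)
    a = + suc α
    b = + β
    w : Fin n → ℕ
    w i = suc α ℕ.* sumFinℕ n wq ℕ.* wp i ℕ.+ β ℕ.* sumFinℕ n wp ℕ.* wq i
    avoids : ∀ i → Z i → w i ≡ 0
    avoids i i∈Z rewrite zp i i∈Z | zq i i∈Z
      | ℕP.*-zeroʳ (suc α ℕ.* sumFinℕ n wq) | ℕP.*-zeroʳ (β ℕ.* sumFinℕ n wp) = refl
    w≡ : ∀ i → + w i ≡ a * Q * + wp i + b * P * + wq i
    w≡ i rewrite sumFin-pos n wp | sumFin-pos n wq =
      trans (ℤP.pos-+ (suc α ℕ.* sumFinℕ n wq ℕ.* wp i) (β ℕ.* sumFinℕ n wp ℕ.* wq i))
        (cong₂ _+_ (trans (ℤP.pos-* (suc α ℕ.* sumFinℕ n wq) (wp i)) (cong (_* + wp i) (ℤP.pos-* (suc α) (sumFinℕ n wq))))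
                   (trans (ℤP.pos-* (β ℕ.* sumFinℕ n wp) (wq i)) (cong (_* + wq i) (ℤP.pos-* β (sumFinℕ n wp)))))
    total : sumFin n (+_ ∘ w) ≡ a * Q * P + b * P * Q
    total = trans (sumFin-cong n w≡) (sumFin-linear n (a * Q) (b * P) (+_ ∘ wp) (+_ ∘ wq))
    total≢0 : sumFin n (+_ ∘ w) ≢ 0ℤ
    total≢0 e = [ (λ ()) , [ P≢0 , Q≢0 ]′ ∘ ℤP.i*j≡0⇒i≡0∨j≡0 P ]′
      (ℤP.i*j≡0⇒i≡0∨j≡0 (a + b) (trans (factor a b P Q) (trans (sym total) e)))
      where
      factor : ∀ a b P Q → (a + b) * (P * Q) ≡ a * Q * P + b * P * Q
      factor = solve-∀
    coordinate : (π : ℤ² → ℤ) →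
      sumFin n (λ i → + wp i * π (v i)) ≡ P * π p → sumFin n (λ i → + wq i * π (v i)) ≡ Q * π q →
      (a + b) * π r ≡ a * π p + b * π q → sumFin n (λ i → + w i * π (v i)) ≡ sumFin n (+_ ∘ w) * π r
    coordinate π hp hq hr =
      trans (sumFin-weighted n (a * Q) (b * P) (+_ ∘ w) (+_ ∘ wp) (+_ ∘ wq) (π ∘ v) w≡)
        (trans (cong₂ (λ s t → a * Q * s + b * P * t) hp hq)
          (trans (mixture-centre a b P Q (π p) (π q) (π r) hr) (cong (_* π r) (sym total))))

cross-mean : ∀ α β (a b p q r : ℤ²) → Mean α β p q r →
  (+ α + + β) * cross a b r ≡ + α * cross a b p + + β * cross a b q
cross-mean α β (ax , ay) (bx , by) (px , py) (qx , qy) (rx , ry) (mean hx hy) = begin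
  S * ((bx - ax) * (ry - ay) - (by - ay) * (rx - ax))
    ≡⟨ expand S ax ay bx by rx ry ⟩
  (bx - ax) * (S * ry - S * ay) - (by - ay) * (S * rx - S * ax)
    ≡⟨ cong₂ (λ s t → (bx - ax) * (s - S * ay) - (by - ay) * (t - S * ax)) hy hx ⟩
  (bx - ax) * (A * py + B * qy - (A + B) * ay) - (by - ay) * (A * px + B * qx - (A + B) * ax)
    ≡⟨ collect A B ax ay bx by px py qx qy ⟩
  A * ((bx - ax) * (py - ay) - (by - ay) * (px - ax)) + B * ((bx - ax) * (qy - ay) - (by - ay) * (qx - ax)) ∎
  where
  open ≡-Reasoning
  A = + α
  B = + β
  S = A + B
  expand : ∀ S ax ay bx by rx ry → S * ((bx - ax) * (ry - ay) - (by - ay) * (rx - ax))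
         ≡ (bx - ax) * (S * ry - S * ay) - (by - ay) * (S * rx - S * ax)
  expand = solve-∀
  collect : ∀ A B ax ay bx by px py qx qy →
    (bx - ax) * (A * py + B * qy - (A + B) * ay) - (by - ay) * (A * px + B * qx - (A + B) * ax)
    ≡ A * ((bx - ax) * (py - ay) - (by - ay) * (px - ax)) + B * ((bx - ax) * (qy - ay) - (by - ay) * (qx - ax))
  collect = solve-∀

cross-mean₂ : ∀ A₁ B₁ A₂ B₂ (z a b q₁ q₂ : ℤ²) → Mean A₁ B₁ a b q₁ → Mean A₂ B₂ a b q₂ →
  (+ A₁ + + B₁) * (+ A₂ + + B₂) * cross z q₁ q₂ ≡ (+ A₁ * + B₂ - + B₁ * + A₂) * cross z a b
cross-mean₂ A₁ B₁ A₂ B₂ (zx , zy) (ax , ay) (bx , by) (x₁ , y₁) (x₂ , y₂) (mean hx₁ hy₁) (mean hx₂ hy₂) = begin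
  S₁ * S₂ * ((x₁ - zx) * (y₂ - zy) - (y₁ - zy) * (x₂ - zx))
    ≡⟨ expand S₁ S₂ zx zy x₁ y₁ x₂ y₂ ⟩
  (S₁ * x₁ - S₁ * zx) * (S₂ * y₂ - S₂ * zy) - (S₁ * y₁ - S₁ * zy) * (S₂ * x₂ - S₂ * zx)
    ≡⟨ cong₂ (λ s t → (s - S₁ * zx) * (S₂ * y₂ - S₂ * zy) - (t - S₁ * zy) * (S₂ * x₂ - S₂ * zx)) hx₁ hy₁ ⟩
  (a₁ * ax + b₁ * bx - S₁ * zx) * (S₂ * y₂ - S₂ * zy) - (a₁ * ay + b₁ * by - S₁ * zy) * (S₂ * x₂ - S₂ * zx)
    ≡⟨ cong₂ (λ s t → (a₁ * ax + b₁ * bx - S₁ * zx) * (s - S₂ * zy) - (a₁ * ay + b₁ * by - S₁ * zy) * (t - S₂ * zx)) hy₂ hx₂ ⟩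
  (a₁ * ax + b₁ * bx - S₁ * zx) * (a₂ * ay + b₂ * by - S₂ * zy) - (a₁ * ay + b₁ * by - S₁ * zy) * (a₂ * ax + b₂ * bx - S₂ * zx)
    ≡⟨ collect a₁ b₁ a₂ b₂ zx zy ax ay bx by ⟩
  (a₁ * b₂ - b₁ * a₂) * ((ax - zx) * (by - zy) - (ay - zy) * (bx - zx)) ∎
  where
  open ≡-Reasoning
  a₁ = + A₁
  b₁ = + B₁
  a₂ = + A₂
  b₂ = + B₂
  S₁ = a₁ + b₁
  S₂ = a₂ + b₂
  expand : ∀ S₁ S₂ zx zy x₁ y₁ x₂ y₂ → S₁ * S₂ * ((x₁ - zx) * (y₂ - zy) - (y₁ - zy) * (x₂ - zx))
         ≡ (S₁ * x₁ - S₁ * zx) * (S₂ * y₂ - S₂ * zy) - (S₁ * y₁ - S₁ * zy) * (S₂ * x₂ - S₂ * zx)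
  expand = solve-∀
  collect : ∀ a₁ b₁ a₂ b₂ zx zy ax ay bx by →
    (a₁ * ax + b₁ * bx - (a₁ + b₁) * zx) * (a₂ * ay + b₂ * by - (a₂ + b₂) * zy)
      - (a₁ * ay + b₁ * by - (a₁ + b₁) * zy) * (a₂ * ax + b₂ * bx - (a₂ + b₂) * zx)
    ≡ (a₁ * b₂ - b₁ * a₂) * ((ax - zx) * (by - zy) - (ay - zy) * (bx - zx))
  collect = solve-∀

cross-rotate : ∀ (a b c : ℤ²) → cross a b c ≡ cross b c a
cross-rotate (ax , ay) (bx , by) (cx , cy) = rotate ax ay bx by cx cy
  where
  rotate : ∀ ax ay bx by cx cy →
    (bx - ax) * (cy - ay) - (by - ay) * (cx - ax) ≡ (cx - bx) * (ay - by) - (cy - by) * (ax - bx)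
  rotate = solve-∀

cross-degenerateˡ : ∀ (a b : ℤ²) → cross a b a ≡ 0ℤ
cross-degenerateˡ (ax , ay) (bx , by) = vanish ax ay bx by
  where
  vanish : ∀ ax ay bx by → (bx - ax) * (ay - ay) - (by - ay) * (ax - ax) ≡ 0ℤ
  vanish = solve-∀

cross-degenerateʳ : ∀ (a b : ℤ²) → cross a b b ≡ 0ℤ
cross-degenerateʳ (ax , ay) (bx , by) = vanish ax ay bx by
  where
  vanish : ∀ ax ay bx by → (bx - ax) * (by - ay) - (by - ay) * (bx - ax) ≡ 0ℤ
  vanish = solve-∀

Between : ℤ² → ℤ² → ℤ² → Set
Between a b r = Σ ℕ λ α → Σ ℕ λ β → Mean (suc α) (suc β) a b r

midpoint-between : ∀ {a b r} → Mean 1 1 a b r → Between a b r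
midpoint-between m = 0 , 0 , m

mean-sym : ∀ {α β p q r} → Mean α β p q r → Mean β α q p r
mean-sym {α} {β} {p} {q} {r} (mean hx hy) = mean (swap (proj₁ p) (proj₁ q) (proj₁ r) hx) (swap (proj₂ p) (proj₂ q) (proj₂ r) hy)
  where
  swap : ∀ x y z → (+ α + + β) * z ≡ + α * x + + β * y → (+ β + + α) * z ≡ + β * y + + α * x
  swap x y z h = trans (cong (_* z) (ℤP.+-comm (+ β) (+ α))) (trans h (ℤP.+-comm (+ α * x) (+ β * y)))

between-sym : ∀ {a b r} → Between a b r → Between b a r
between-sym (α , β , m) = β , α , mean-sym m

between-collinear : ∀ {a b r} → Between a b r → cross a b r ≡ 0ℤ
between-collinear {a} {b} {r} (α , β , m) = positive-factor (α ℕ.+ suc β) (begin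
  (+ suc α + + suc β) * cross a b r              ≡⟨ cross-mean (suc α) (suc β) a b a b r m ⟩
  + suc α * cross a b a + + suc β * cross a b b  ≡⟨ cong₂ (λ s t → + suc α * s + + suc β * t) (cross-degenerateˡ a b) (cross-degenerateʳ a b) ⟩
  + suc α * 0ℤ + + suc β * 0ℤ                    ≡⟨ cong₂ _+_ (ℤP.*-zeroʳ (+ suc α)) (ℤP.*-zeroʳ (+ suc β)) ⟩
  0ℤ                                             ∎)
  where open ≡-Reasoning

cross-between-≢0 : ∀ a b {r s q} → Between r s q → cross a b r ≢ 0ℤ → cross a b s ≡ 0ℤ → cross a b q ≢ 0ℤ
cross-between-≢0 a b {r} {s} {q} (α , β , m) r∉ab s∈ab q∈ab = r∉ab (positive-factor α (begin
  + suc α * cross a b r                              ≡⟨ sym (ℤP.+-identityʳ _) ⟩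
  + suc α * cross a b r + 0ℤ                         ≡⟨ cong (_+_ (+ suc α * cross a b r)) (sym (ℤP.*-zeroʳ (+ suc β))) ⟩
  + suc α * cross a b r + + suc β * 0ℤ               ≡⟨ cong (λ t → + suc α * cross a b r + + suc β * t) (sym s∈ab) ⟩
  + suc α * cross a b r + + suc β * cross a b s      ≡⟨ sym (cross-mean (suc α) (suc β) a b r s q m) ⟩
  (+ suc α + + suc β) * cross a b q                  ≡⟨ cong (_*_ (+ suc α + + suc β)) q∈ab ⟩
  (+ suc α + + suc β) * 0ℤ                           ≡⟨ ℤP.*-zeroʳ (+ suc α + + suc β) ⟩
  0ℤ                                                 ∎))
  where open ≡-Reasoning

between-≢ˡ : ∀ {a b r} → Between a b r → a ≢ b → r ≢ a
between-≢ˡ {a} {b} (α , β , mean mx my) a≢b refl = a≢b (cong₂ _,_ (cancel mx) (cancel my))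
  where
  cancel : ∀ {x y} → (+ suc α + + suc β) * x ≡ + suc α * x + + suc β * y → x ≡ y
  cancel {x} {y} h = ℤP.*-cancelˡ-≡ (+ suc β) x y
    (+-cancelˡ (+ suc α * x) (+ suc β * x) (+ suc β * y) (trans (sym (ℤP.*-distribʳ-+ x (+ suc α) (+ suc β))) h))

between-≢ʳ : ∀ {a b r} → Between a b r → a ≢ b → r ≢ b
between-≢ʳ r∈ab a≢b = between-≢ˡ (between-sym r∈ab) (a≢b ∘ sym)

mean-transˡ : ∀ a b g h {e₁ e₂ p q : ℤ²} → Mean a b e₁ p q → Mean g h e₁ e₂ p →
  Mean (a ℕ.* (g ℕ.+ h) ℕ.+ b ℕ.* g) (b ℕ.* h) e₁ e₂ q
mean-transˡ a b g h (mean qx qy) (mean px py) = mean (coordinate qx px) (coordinate qy py)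
  where
  A' = a ℕ.* (g ℕ.+ h) ℕ.+ b ℕ.* g
  B' = b ℕ.* h
  A'≡ : + A' ≡ + a * (+ g + + h) + + b * + g
  A'≡ = trans (ℤP.pos-+ (a ℕ.* (g ℕ.+ h)) (b ℕ.* g))
    (cong₂ _+_ (trans (ℤP.pos-* a (g ℕ.+ h)) (cong (+ a *_) (ℤP.pos-+ g h))) (ℤP.pos-* b g))
  compose : ∀ A B G H e₁ e₂ p q → (A + B) * q ≡ A * e₁ + B * p → (G + H) * p ≡ G * e₁ + H * e₂ →
    (A * (G + H) + B * G + B * H) * q ≡ (A * (G + H) + B * G) * e₁ + B * H * e₂
  compose A B G H e₁ e₂ p q hq hp = begin
    (A * (G + H) + B * G + B * H) * q  ≡⟨ factor A B G H q ⟩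
    (G + H) * ((A + B) * q)            ≡⟨ cong ((G + H) *_) hq ⟩
    (G + H) * (A * e₁ + B * p)         ≡⟨ distribute A B G H e₁ p ⟩
    A * (G + H) * e₁ + B * ((G + H) * p) ≡⟨ cong (λ s → A * (G + H) * e₁ + B * s) hp ⟩
    A * (G + H) * e₁ + B * (G * e₁ + H * e₂) ≡⟨ collect A B G H e₁ e₂ ⟩
    (A * (G + H) + B * G) * e₁ + B * H * e₂ ∎
    where
    open ≡-Reasoning
    factor : ∀ A B G H q → (A * (G + H) + B * G + B * H) * q ≡ (G + H) * ((A + B) * q)
    factor = solve-∀
    distribute : ∀ A B G H e₁ p → (G + H) * (A * e₁ + B * p) ≡ A * (G + H) * e₁ + B * ((G + H) * p)
    distribute = solve-∀
    collect : ∀ A B G H e₁ e₂ → A * (G + H) * e₁ + B * (G * e₁ + H * e₂) ≡ (A * (G + H) + B * G) * e₁ + B * H * e₂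
    collect = solve-∀
  coordinate : ∀ {e₁ e₂ p q} → (+ a + + b) * q ≡ + a * e₁ + + b * p → (+ g + + h) * p ≡ + g * e₁ + + h * e₂ →
    (+ A' + + B') * q ≡ + A' * e₁ + + B' * e₂
  coordinate {e₁} {e₂} {p} {q} hq hp = subst₂ (λ A B → (A + B) * q ≡ A * e₁ + B * e₂) (sym A'≡) (sym (ℤP.pos-* b h))
    (compose (+ a) (+ b) (+ g) (+ h) e₁ e₂ p q hq hp)

mean-transʳ : ∀ a b g h {e₁ e₂ p q : ℤ²} → Mean a b p e₂ q → Mean g h e₁ e₂ p →
  Mean (a ℕ.* g) (b ℕ.* (h ℕ.+ g) ℕ.+ a ℕ.* h) e₁ e₂ q
mean-transʳ a b g h q∈ p∈ = mean-sym (mean-transˡ b a h g (mean-sym q∈) (mean-sym p∈))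

between-transˡ : ∀ {a b p q} → Between a p q → Between a b p → Between a b q
between-transˡ (α , β , q∈) (γ , δ , p∈) = _ , _ , mean-transˡ (suc α) (suc β) (suc γ) (suc δ) q∈ p∈

between-transʳ : ∀ {a b p q} → Between p b q → Between a b p → Between a b q
between-transʳ (α , β , q∈) (γ , δ , p∈) = _ , _ , mean-transʳ (suc α) (suc β) (suc γ) (suc δ) q∈ p∈

cross-mean₂-≢0 : ∀ {A₁ B₁ A₂ B₂ z a b q₁ q₂} → Mean A₁ B₁ a b q₁ → Mean A₂ B₂ a b q₂ →
  A₁ ℕ.* B₂ ≢ B₁ ℕ.* A₂ → cross z a b ≢ 0ℤ → cross z q₁ q₂ ≢ 0ℤ
cross-mean₂-≢0 {A₁} {B₁} {A₂} {B₂} {z} {a} {b} {q₁} {q₂} q₁∈ q₂∈ A₁B₂≢B₁A₂ z∉ab q₁q₂∋z =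
  [ A₁B₂≢B₁A₂ ∘ equal-products , z∉ab ]′ (ℤP.i*j≡0⇒i≡0∨j≡0 (+ A₁ * + B₂ - + B₁ * + A₂) product≡0)
  where
  product≡0 : (+ A₁ * + B₂ - + B₁ * + A₂) * cross z a b ≡ 0ℤ
  product≡0 = trans (sym (cross-mean₂ A₁ B₁ A₂ B₂ z a b q₁ q₂ q₁∈ q₂∈))
    (trans (cong ((+ A₁ + + B₁) * (+ A₂ + + B₂) *_) q₁q₂∋z) (ℤP.*-zeroʳ ((+ A₁ + + B₁) * (+ A₂ + + B₂))))
  equal-products : + A₁ * + B₂ - + B₁ * + A₂ ≡ 0ℤ → A₁ ℕ.* B₂ ≡ B₁ ℕ.* A₂
  equal-products d≡0 = ℤP.+-injective (trans (ℤP.pos-* A₁ B₂)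
    (trans (ℤP.i-j≡0⇒i≡j (+ A₁ * + B₂) (+ B₁ * + A₂) d≡0) (sym (ℤP.pos-* B₁ A₂))))

-- q₁ and q₂ are separated by p, so their barycentric coordinates on ab differ.
cross-separated-≢0 : ∀ {a b p q₁ q₂} (z : ℤ²) → Between a p q₁ → Between p b q₂ → Between a b p →
  cross z a b ≢ 0ℤ → cross z q₁ q₂ ≢ 0ℤ
cross-separated-≢0 z (α , β , q₁∈) (α' , β' , q₂∈) (γ , δ , p∈) =
  cross-mean₂-≢0 (mean-transˡ A B G H q₁∈ p∈) (mean-transʳ A' B' G H q₂∈ p∈)
    (λ e → ℕP.m+1+n≢m (B ℕ.* H ℕ.* (A' ℕ.* G)) (trans (sym (expand A B A' B' G H)) e))
  where
  A = suc α
  B = suc β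
  A' = suc α'
  B' = suc β'
  G = suc γ
  H = suc δ
  expand : ∀ A B A' B' G H →
    (A ℕ.* (G ℕ.+ H) ℕ.+ B ℕ.* G) ℕ.* (B' ℕ.* (H ℕ.+ G) ℕ.+ A' ℕ.* H)
    ≡ B ℕ.* H ℕ.* (A' ℕ.* G) ℕ.+ (A ℕ.* (G ℕ.+ H) ℕ.* (B' ℕ.* (H ℕ.+ G) ℕ.+ A' ℕ.* H) ℕ.+ B ℕ.* G ℕ.* (B' ℕ.* (H ℕ.+ G)))
  expand = ℕ-solve-∀

midpoint-unique : ∀ {a b m n} g → Mean 1 1 a b m → Mean (suc g) (suc g) a b n → m ≡ n
midpoint-unique {a} {b} {m} {n} g (mean mx my) (mean nx ny) = cong₂ _,_ (coordinate (proj₁ a) (proj₁ b) mx nx) (coordinate (proj₂ a) (proj₂ b) my ny)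
  where
  G = + suc g
  coordinate : ∀ x y {m n} → (+ 1 + + 1) * m ≡ + 1 * x + + 1 * y → (G + G) * n ≡ G * x + G * y → m ≡ n
  coordinate x y {m} {n} hm hn = ℤP.*-cancelˡ-≡ (G + G) m n (begin
    (G + G) * m          ≡⟨ halve G m ⟩
    G * ((+ 1 + + 1) * m) ≡⟨ cong (G *_) hm ⟩
    G * (+ 1 * x + + 1 * y) ≡⟨ spread G x y ⟩
    G * x + G * y        ≡⟨ sym hn ⟩
    (G + G) * n          ∎)
    where
    open ≡-Reasoning
    halve : ∀ G m → (G + G) * m ≡ G * ((+ 1 + + 1) * m)
    halve = solve-∀
    spread : ∀ G x y → G * (+ 1 * x + + 1 * y) ≡ G * x + G * y
    spread = solve-∀

data LinePosition (a b p : ℤ²) : Set where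
  at-start : p ≡ a → LinePosition a b p
  at-end   : p ≡ b → LinePosition a b p
  inside   : Between a b p → LinePosition a b p
  before   : Between p b a → LinePosition a b p
  after    : Between p a b → LinePosition a b p

Proportional : ℕ → ℤ → ℤ² → ℤ² → ℤ² → Set
Proportional N t a b p =
  (+ N * (proj₁ p - proj₁ a) ≡ t * (proj₁ b - proj₁ a)) × (+ N * (proj₂ p - proj₂ a) ≡ t * (proj₂ b - proj₂ a))

collinear⇒proportional : ∀ {a b p} → a ≢ b → cross a b p ≡ 0ℤ →
  Σ ℕ λ N → Σ ℤ λ t → N ≢ 0 × Proportional N t a b p
collinear⇒proportional {ax , ay} {bx , by} {px , py} a≢b cross≡0 = N , t , N≢0 , along-x , along-y
  where
  dx = bx - ax
  dy = by - ay
  N = ∣ dx ∣ ℕ.* ∣ dx ∣ ℕ.+ ∣ dy ∣ ℕ.* ∣ dy ∣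
  t = dx * (px - ax) + dy * (py - ay)
  square : ∀ x → + (∣ x ∣ ℕ.* ∣ x ∣) ≡ x * x
  square (+ n)    = ℤP.pos-* n n
  square -[1+ n ] = refl
  N≡ : + N ≡ dx * dx + dy * dy
  N≡ = trans (ℤP.pos-+ (∣ dx ∣ ℕ.* ∣ dx ∣) _) (cong₂ _+_ (square dx) (square dy))
  zero-square : ∀ x → ∣ x ∣ ℕ.* ∣ x ∣ ≡ 0 → x ≡ 0ℤ
  zero-square x e = [ ℤP.∣i∣≡0⇒i≡0 , ℤP.∣i∣≡0⇒i≡0 ]′ (ℕP.m*n≡0⇒m≡0∨n≡0 ∣ x ∣ e)
  N≢0 : N ≢ 0
  N≢0 e = a≢b (sym (cong₂ _,_
    (ℤP.i-j≡0⇒i≡j bx ax (zero-square dx (ℕP.m+n≡0⇒m≡0 _ e)))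
    (ℤP.i-j≡0⇒i≡j by ay (zero-square dy (ℕP.m+n≡0⇒n≡0 (∣ dx ∣ ℕ.* ∣ dx ∣) e)))))
  project-x : ∀ dx dy x y → (dx * dx + dy * dy) * x ≡ (dx * x + dy * y) * dx - dy * (dx * y - dy * x)
  project-x = solve-∀
  project-y : ∀ dx dy x y → (dx * dx + dy * dy) * y ≡ (dx * x + dy * y) * dy + dx * (dx * y - dy * x)
  project-y = solve-∀
  along-x : + N * (px - ax) ≡ t * dx
  along-x = trans (cong (_* (px - ax)) N≡) (trans (project-x dx dy (px - ax) (py - ay))
    (trans (cong (λ c → t * dx - dy * c) cross≡0) (trans (cong (_-_ (t * dx)) (ℤP.*-zeroʳ dy)) (ℤP.+-identityʳ _))))
  along-y : + N * (py - ay) ≡ t * dy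
  along-y = trans (cong (_* (py - ay)) N≡) (trans (project-y dx dy (px - ax) (py - ay))
    (trans (cong (λ c → t * dy + dx * c) cross≡0) (trans (cong (_+_ (t * dy)) (ℤP.*-zeroʳ dx)) (ℤP.+-identityʳ _))))

proportional-zero : ∀ D x₀ x₁ x → + suc D * (x - x₀) ≡ 0ℤ * (x₁ - x₀) → x ≡ x₀
proportional-zero D x₀ x₁ x h = ℤP.i-j≡0⇒i≡j x x₀ (positive-factor D h)

proportional-equal : ∀ D x₀ x₁ x → + suc D * (x - x₀) ≡ + suc D * (x₁ - x₀) → x ≡ x₁
proportional-equal D x₀ x₁ x h =
  trans (sym (shift x x₀)) (trans (cong (_+ x₀) (ℤP.*-cancelˡ-≡ (+ suc D) (x - x₀) (x₁ - x₀) h)) (shift x₁ x₀))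
  where
  shift : ∀ x x₀ → x - x₀ + x₀ ≡ x
  shift = solve-∀

proportional-negative : ∀ N S x₀ x₁ x → N * (x - x₀) ≡ - S * (x₁ - x₀) → (N + S) * x₀ ≡ N * x + S * x₁
proportional-negative N S x₀ x₁ x h = sym (begin
  N * x + S * x₁                      ≡⟨ split N S x₀ x₁ x ⟩
  N * (x - x₀) + (N * x₀ + S * x₁)    ≡⟨ cong (_+ (N * x₀ + S * x₁)) h ⟩
  - S * (x₁ - x₀) + (N * x₀ + S * x₁) ≡⟨ collect N S x₀ x₁ ⟩
  (N + S) * x₀                        ∎)
  where
  open ≡-Reasoning
  split : ∀ N S x₀ x₁ x → N * x + S * x₁ ≡ N * (x - x₀) + (N * x₀ + S * x₁)
  split = solve-∀
  collect : ∀ N S x₀ x₁ → - S * (x₁ - x₀) + (N * x₀ + S * x₁) ≡ (N + S) * x₀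
  collect = solve-∀

proportional-inside : ∀ N K S x₀ x₁ x → N ≡ K + S → N * (x - x₀) ≡ S * (x₁ - x₀) → (K + S) * x ≡ K * x₀ + S * x₁
proportional-inside N K S x₀ x₁ x N≡ h = begin
  (K + S) * x                       ≡⟨ split K S x₀ x ⟩
  (K + S) * (x - x₀) + (K + S) * x₀ ≡⟨ cong (λ c → c * (x - x₀) + (K + S) * x₀) (sym N≡) ⟩
  N * (x - x₀) + (K + S) * x₀       ≡⟨ cong (_+ (K + S) * x₀) h ⟩
  S * (x₁ - x₀) + (K + S) * x₀      ≡⟨ collect K S x₀ x₁ ⟩
  K * x₀ + S * x₁                   ∎
  where
  open ≡-Reasoning
  split : ∀ K S x₀ x → (K + S) * x ≡ (K + S) * (x - x₀) + (K + S) * x₀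
  split = solve-∀
  collect : ∀ K S x₀ x₁ → S * (x₁ - x₀) + (K + S) * x₀ ≡ K * x₀ + S * x₁
  collect = solve-∀

proportional-beyond : ∀ N K T x₀ x₁ x → T ≡ N + K → N * (x - x₀) ≡ T * (x₁ - x₀) → (N + K) * x₁ ≡ N * x + K * x₀
proportional-beyond N K T x₀ x₁ x T≡ h = sym (begin
  N * x + K * x₀                     ≡⟨ split N K x₀ x ⟩
  N * (x - x₀) + (N + K) * x₀        ≡⟨ cong (_+ (N + K) * x₀) h ⟩
  T * (x₁ - x₀) + (N + K) * x₀       ≡⟨ cong (λ c → c * (x₁ - x₀) + (N + K) * x₀) T≡ ⟩
  (N + K) * (x₁ - x₀) + (N + K) * x₀ ≡⟨ collect N K x₀ x₁ ⟩
  (N + K) * x₁                       ∎)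
  where
  open ≡-Reasoning
  split : ∀ N K x₀ x → N * x + K * x₀ ≡ N * (x - x₀) + (N + K) * x₀
  split = solve-∀
  collect : ∀ N K x₀ x₁ → (N + K) * (x₁ - x₀) + (N + K) * x₀ ≡ (N + K) * x₁
  collect = solve-∀

proportional-position : ∀ {a b p} N t → N ≢ 0 → Proportional N t a b p → LinePosition a b p
proportional-position zero _ N≢0 _ = ⊥-elim (N≢0 refl)
proportional-position {a} {b} {p} (suc D) (+ zero) _ (hx , hy) = at-start (cong₂ _,_
  (proportional-zero D (proj₁ a) (proj₁ b) (proj₁ p) hx) (proportional-zero D (proj₂ a) (proj₂ b) (proj₂ p) hy))
proportional-position {a} {b} {p} (suc D) -[1+ s ] _ (hx , hy) = before (D , s , mean
  (proportional-negative (+ suc D) (+ suc s) (proj₁ a) (proj₁ b) (proj₁ p) hx)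
  (proportional-negative (+ suc D) (+ suc s) (proj₂ a) (proj₂ b) (proj₂ p) hy))
proportional-position {a} {b} {p} (suc D) (+ suc s) _ (hx , hy) with ℕ.compare s D
... | ℕ.less .s k = inside (k , s , mean
  (proportional-inside (+ suc (suc (s ℕ.+ k))) (+ suc k) (+ suc s) (proj₁ a) (proj₁ b) (proj₁ p) N≡ hx)
  (proportional-inside (+ suc (suc (s ℕ.+ k))) (+ suc k) (+ suc s) (proj₂ a) (proj₂ b) (proj₂ p) N≡ hy))
  where
  N≡ : + suc (suc (s ℕ.+ k)) ≡ + suc k + + suc s
  N≡ = cong +_ (reorder s k)
    where
    reorder : ∀ s k → suc (suc (s ℕ.+ k)) ≡ suc k ℕ.+ suc s
    reorder = ℕ-solve-∀
... | ℕ.equal .D = at-end (cong₂ _,_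
  (proportional-equal D (proj₁ a) (proj₁ b) (proj₁ p) hx) (proportional-equal D (proj₂ a) (proj₂ b) (proj₂ p) hy))
... | ℕ.greater .D k = after (D , k , mean
  (proportional-beyond (+ suc D) (+ suc k) (+ suc (suc (D ℕ.+ k))) (proj₁ a) (proj₁ b) (proj₁ p) T≡ hx)
  (proportional-beyond (+ suc D) (+ suc k) (+ suc (suc (D ℕ.+ k))) (proj₂ a) (proj₂ b) (proj₂ p) T≡ hy))
  where
  T≡ : + suc (suc (D ℕ.+ k)) ≡ + suc D + + suc k
  T≡ = cong +_ (sym (ℕP.+-suc (suc D) k))

collinear-position : ∀ {a b p} → a ≢ b → cross a b p ≡ 0ℤ → LinePosition a b p
collinear-position {a} {b} {p} a≢b cross≡0 with collinear⇒proportional {a} {b} {p} a≢b cross≡0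
... | N , t , N≢0 , proportional = proportional-position {a} {b} {p} N t N≢0 proportional

-- Parity classes

data Parity (x : ℤ) : Set where
  even : ∀ q → x ≡ q + q → Parity x
  odd  : ∀ q → x ≡ q + q + 1ℤ → Parity x

parity : ∀ x → Parity x
parity x = from-remainder (x DM.% + 2) (DM.a≡a%n+[a/n]*n x (+ 2)) (DM.n%d<d x (+ 2))
  where
  q = x DM./ + 2
  from-remainder : ∀ r → x ≡ + r + q * + 2 → r ℕ.< 2 → Parity x
  from-remainder 0 e _ = even q (trans e (twice q))
    where
    twice : ∀ q → + 0 + q * + 2 ≡ q + q
    twice = solve-∀
  from-remainder 1 e _ = odd q (trans e (twice q))
    where
    twice : ∀ q → + 1 + q * + 2 ≡ q + q + 1ℤ
    twice = solve-∀
  from-remainder (suc (suc r)) _ (ℕ.s≤s (ℕ.s≤s ()))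

double≢1 : ∀ d → d + d ≢ 1ℤ
double≢1 (+ zero)  ()
double≢1 (+ suc n) e = ℕP.m+1+n≢0 n (ℕP.suc-injective (ℤP.+-injective e))
double≢1 -[1+ n ]  ()

even≢odd : ∀ q r → q + q ≢ r + r + 1ℤ
even≢odd q r e = double≢1 (q - r) (trans (regroup q r) (trans (cong (_- (r + r)) e) (cancel r)))
  where
  regroup : ∀ q r → q - r + (q - r) ≡ q + q - (r + r)
  regroup = solve-∀
  cancel : ∀ r → r + r + 1ℤ - (r + r) ≡ 1ℤ
  cancel = solve-∀

isOdd : ℤ → Bool
isOdd x with parity x
... | even _ _ = false
... | odd _ _  = true

isOdd-even : ∀ {x} q → x ≡ q + q → isOdd x ≡ false
isOdd-even {x} q e with parity x
... | even _ _   = refl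
... | odd r e'   = ⊥-elim (even≢odd q r (trans (sym e) e'))

isOdd-odd : ∀ {x} q → x ≡ q + q + 1ℤ → isOdd x ≡ true
isOdd-odd {x} q e with parity x
... | even r e'  = ⊥-elim (even≢odd r q (trans (sym e') e))
... | odd _ _    = refl

isOdd-+ : ∀ x y → isOdd (x + y) ≡ isOdd x xor isOdd y
isOdd-+ x y with parity x | parity y
... | even q ex | even r ey = isOdd-even (q + r) (trans (cong₂ _+_ ex ey) (regroup q r))
  where
  regroup : ∀ q r → q + q + (r + r) ≡ q + r + (q + r)
  regroup = solve-∀
... | even q ex | odd r ey = isOdd-odd (q + r) (trans (cong₂ _+_ ex ey) (regroup q r))
  where
  regroup : ∀ q r → q + q + (r + r + 1ℤ) ≡ q + r + (q + r) + 1ℤ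
  regroup = solve-∀
... | odd q ex | even r ey = isOdd-odd (q + r) (trans (cong₂ _+_ ex ey) (regroup q r))
  where
  regroup : ∀ q r → q + q + 1ℤ + (r + r) ≡ q + r + (q + r) + 1ℤ
  regroup = solve-∀
... | odd q ex | odd r ey = isOdd-even (q + r + 1ℤ) (trans (cong₂ _+_ ex ey) (regroup q r))
  where
  regroup : ∀ q r → q + q + 1ℤ + (r + r + 1ℤ) ≡ q + r + 1ℤ + (q + r + 1ℤ)
  regroup = solve-∀

isOdd≡false⇒even : ∀ x → isOdd x ≡ false → Σ ℤ λ q → x ≡ q + q
isOdd≡false⇒even x e with parity x
... | even q e' = q , e'
... | odd _ _ with () ← e

infixl 6 _⊕_ _⊞_

_⊕_ : ℤ² → ℤ² → ℤ²
(x , y) ⊕ (x' , y') = x + x' , y + y'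

Class : Set
Class = Bool × Bool

𝟎 : Class
𝟎 = false , false

_⊞_ : Class → Class → Class
(a , b) ⊞ (c , d) = a xor c , b xor d

class : ℤ² → Class
class (x , y) = isOdd x , isOdd y

class-⊕ : ∀ p q → class (p ⊕ q) ≡ class p ⊞ class q
class-⊕ (x , y) (x' , y') = cong₂ _,_ (isOdd-+ x x') (isOdd-+ y y')

class≡𝟎⇒double : ∀ p → class p ≡ 𝟎 → Σ ℤ² λ t → p ≡ t ⊕ t
class≡𝟎⇒double (x , y) e with isOdd≡false⇒even x (cong proj₁ e) | isOdd≡false⇒even y (cong proj₂ e)
... | q , refl | r , refl = (q , r) , refl

double⇒In2Z2 : ∀ {p} t → p ≡ t ⊕ t → In2Z2 p
double⇒In2Z2 (q , r) refl = (q , r) , sym (twice q) , sym (twice r)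
  where
  twice : ∀ q → + 2 * q ≡ q + q
  twice = solve-∀

xor-cancelˡ : ∀ a b → a xor b ≡ a → b ≡ false
xor-cancelˡ true  true  ()
xor-cancelˡ true  false _ = refl
xor-cancelˡ false b     e = e

⊞-cancelˡ : ∀ c d → c ⊞ d ≡ c → d ≡ 𝟎
⊞-cancelˡ (a , b) (c , d) e = cong₂ _,_ (xor-cancelˡ a c (cong proj₁ e)) (xor-cancelˡ b d (cong proj₂ e))

same-class⇒even-offset : ∀ a b → class a ≡ class b → Σ ℤ² λ u → b ≡ a ⊕ (u ⊕ u)
same-class⇒even-offset (ax , ay) (bx , by) e = proj₁ half , trans b≡a⊕d (cong (a ⊕_) (proj₂ half))
  where
  a = ax , ay
  d = bx - ax , by - ay
  b≡a⊕d : (bx , by) ≡ a ⊕ d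
  b≡a⊕d = cong₂ _,_ (shift ax bx) (shift ay by)
    where
    shift : ∀ x₀ x → x ≡ x₀ + (x - x₀)
    shift = solve-∀
  class-b : class a ⊞ class d ≡ class a
  class-b = trans (sym (class-⊕ a d)) (trans (cong class (sym b≡a⊕d)) (sym e))
  half = class≡𝟎⇒double d (⊞-cancelˡ (class a) (class d) class-b)

infix 4 _≟ᶜ_

_≟ᶜ_ : (c d : Class) → Dec (c ≡ d)
_≟ᶜ_ = ≡-dec Bool._≟_ Bool._≟_

all-bools? : {P : Bool → Set} → (∀ b → Dec (P b)) → Dec (∀ b → P b)
all-bools? P? = map′ (λ (t , f) → λ { true → t ; false → f }) (λ h → h true , h false) (P? true ×-dec P? false)

all-classes? : {P : Class → Set} → (∀ c → Dec (P c)) → Dec (∀ c → P c)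
all-classes? P? = map′ (λ h (a , b) → h a b) (λ h a b → h (a , b)) (all-bools? λ a → all-bools? λ b → P? (a , b))

corner-or-side-even : ∀ a u w →
  (a ≡ 𝟎 ⊎ a ⊞ u ≡ 𝟎 ⊎ a ⊞ w ≡ 𝟎 ⊎ a ⊞ u ⊞ w ≡ 𝟎) ⊎ (u ≡ 𝟎 ⊎ w ≡ 𝟎 ⊎ u ⊞ w ≡ 𝟎)
corner-or-side-even = from-yes (all-classes? λ a → all-classes? λ u → all-classes? λ w →
  ((a ≟ᶜ 𝟎) ⊎-dec (a ⊞ u ≟ᶜ 𝟎) ⊎-dec (a ⊞ w ≟ᶜ 𝟎) ⊎-dec (a ⊞ u ⊞ w ≟ᶜ 𝟎))
  ⊎-dec ((u ≟ᶜ 𝟎) ⊎-dec (w ≟ᶜ 𝟎) ⊎-dec (u ⊞ w ≟ᶜ 𝟎)))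

classes-exhaust : ∀ A B C → A ≢ 𝟎 → B ≢ 𝟎 → C ≢ 𝟎 → A ≢ B → A ≢ C → B ≢ C →
  ∀ x → x ≡ 𝟎 ⊎ x ≡ A ⊎ x ≡ B ⊎ x ≡ C
classes-exhaust = from-yes (all-classes? λ A → all-classes? λ B → all-classes? λ C →
  ¬? (A ≟ᶜ 𝟎) →-dec ¬? (B ≟ᶜ 𝟎) →-dec ¬? (C ≟ᶜ 𝟎) →-dec ¬? (A ≟ᶜ B) →-dec ¬? (A ≟ᶜ C) →-dec ¬? (B ≟ᶜ C) →-dec
  all-classes? λ x → (x ≟ᶜ 𝟎) ⊎-dec (x ≟ᶜ A) ⊎-dec (x ≟ᶜ B) ⊎-dec (x ≟ᶜ C))

decode : Fin 3 → Class
decode zero             = false , true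
decode (suc zero)       = true , false
decode (suc (suc zero)) = true , true

code : ∀ c → c ≢ 𝟎 → Fin 3
code (false , false) c≢𝟎 = ⊥-elim (c≢𝟎 refl)
code (false , true)  _   = zero
code (true , false)  _   = suc zero
code (true , true)   _   = suc (suc zero)

decode-code : ∀ c (c≢𝟎 : c ≢ 𝟎) → decode (code c c≢𝟎) ≡ c
decode-code (false , false) c≢𝟎 = ⊥-elim (c≢𝟎 refl)
decode-code (false , true)  _   = refl
decode-code (true , false)  _   = refl
decode-code (true , true)   _   = refl

collision : ∀ {n} (d : Fin n → Class) → (∀ i → d i ≢ 𝟎) → 3 ℕ.< n → ∃ λ i → ∃ λ j → i ≢ j × d j ≡ d i
collision d d≢𝟎 3<n with FinP.pigeonhole 3<n (λ i → code (d i) (d≢𝟎 i))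
... | i , j , i<j , same-code = i , j , FinP.<⇒≢ i<j ,
  trans (sym (decode-code (d j) (d≢𝟎 j))) (trans (cong decode (sym same-code)) (decode-code (d i) (d≢𝟎 i)))

no-cover : (f : Fin 4 → Fin 5) → ¬ (∀ k → ∃ λ t → f t ≡ k)
no-cover f cover with FinP.injective⇒≤ {f = proj₁ ∘ cover} injective
  where
  injective : ∀ {k l} → proj₁ (cover k) ≡ proj₁ (cover l) → k ≡ l
  injective {k} {l} e = trans (sym (proj₂ (cover k))) (trans (cong f e) (proj₂ (cover l)))
... | ℕ.s≤s (ℕ.s≤s (ℕ.s≤s (ℕ.s≤s ())))

record Triple {n} (d : Fin n → Class) : Set where
  field
    i j k : Fin n
    i≢j : i ≢ j
    i≢k : i ≢ k
    j≢k : j ≢ k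
    dj≡di : d j ≡ d i
    dk≡di : d k ≡ d i

record TwoTwoOne (d : Fin 5 → Class) : Set where
  field
    x₁ x₂ y₁ y₂ z : Fin 5
    x₁≢x₂ : x₁ ≢ x₂
    y₁≢y₂ : y₁ ≢ y₂
    dx₂≡dx₁ : d x₂ ≡ d x₁
    dy₂≡dy₁ : d y₂ ≡ d y₁
    dx≢dy : d x₁ ≢ d y₁
    dx≢dz : d x₁ ≢ d z
    dy≢dz : d y₁ ≢ d z

swap-pairs : ∀ {d} → TwoTwoOne d → TwoTwoOne d
swap-pairs c = record
  { x₁ = y₁ ; x₂ = y₂ ; y₁ = x₁ ; y₂ = x₂ ; z = z ; x₁≢x₂ = y₁≢y₂ ; y₁≢y₂ = x₁≢x₂
  ; dx₂≡dx₁ = dy₂≡dy₁ ; dy₂≡dy₁ = dx₂≡dx₁ ; dx≢dy = dx≢dy ∘ sym ; dx≢dz = dy≢dz ; dy≢dz = dx≢dz }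
  where open TwoTwoOne c

pair-or-triple : ∀ {n} (d : Fin n → Class) {i j} → i ≢ j → d j ≡ d i →
  Triple d ⊎ (∀ x → d x ≡ d i → x ≡ i ⊎ x ≡ j)
pair-or-triple d {i} {j} i≢j dj≡di with FinP.any? (λ x → ¬? (x FinP.≟ i) ×-dec ¬? (x FinP.≟ j) ×-dec (d x ≟ᶜ d i))
... | yes (k , k≢i , k≢j , dk≡di) = inj₁ (record
  { i = i ; j = j ; k = k ; i≢j = i≢j ; i≢k = k≢i ∘ sym ; j≢k = k≢j ∘ sym ; dj≡di = dj≡di ; dk≡di = dk≡di })
... | no no-third = inj₂ only
  where
  only : ∀ x → d x ≡ d i → x ≡ i ⊎ x ≡ j
  only x dx≡di with x FinP.≟ i | x FinP.≟ j
  ... | yes x≡i | _       = inj₁ x≡i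
  ... | no _    | yes x≡j = inj₂ x≡j
  ... | no x≢i  | no x≢j  = ⊥-elim (no-third (x , x≢i , x≢j , dx≡di))

module _ (d : Fin 5 → Class) (d≢𝟎 : ∀ i → d i ≢ 𝟎) where

  private
    four : Fin 5 → Fin 5 → Fin 5 → Fin 5 → Fin 4 → Fin 5
    four a b c e zero                   = a
    four a b c e (suc zero)             = b
    four a b c e (suc (suc zero))       = c
    four a b c e (suc (suc (suc zero))) = e

  two-pairs⇒TwoTwoOne : ∀ {i₁ i₂ j₁ j₂} → i₁ ≢ i₂ → j₁ ≢ j₂ → d i₂ ≡ d i₁ → d j₂ ≡ d j₁ → d i₁ ≢ d j₁ →
    (∀ x → d x ≡ d i₁ → x ≡ i₁ ⊎ x ≡ i₂) → (∀ x → d x ≡ d j₁ → x ≡ j₁ ⊎ x ≡ j₂) → TwoTwoOne d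
  two-pairs⇒TwoTwoOne {i₁} {i₂} {j₁} {j₂} i₁≢i₂ j₁≢j₂ di dj dA≢dB onlyA onlyB
    with FinP.any? (λ k → ¬? (d i₁ ≟ᶜ d k) ×-dec ¬? (d j₁ ≟ᶜ d k))
  ... | yes (k , A≢C , B≢C) = record
    { x₁ = i₁ ; x₂ = i₂ ; y₁ = j₁ ; y₂ = j₂ ; z = k ; x₁≢x₂ = i₁≢i₂ ; y₁≢y₂ = j₁≢j₂
    ; dx₂≡dx₁ = di ; dy₂≡dy₁ = dj ; dx≢dy = dA≢dB ; dx≢dz = A≢C ; dy≢dz = B≢C }
  ... | no no-fifth-class = ⊥-elim (no-cover (four i₁ i₂ j₁ j₂) covered)
    where
    covered : ∀ k → ∃ λ t → four i₁ i₂ j₁ j₂ t ≡ k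
    covered k with d i₁ ≟ᶜ d k | d j₁ ≟ᶜ d k
    ... | yes A≡C | _ = [ (λ { refl → zero , refl }) , (λ { refl → suc zero , refl }) ]′ (onlyA k (sym A≡C))
    ... | no _ | yes B≡C = [ (λ { refl → suc (suc zero) , refl }) , (λ { refl → suc (suc (suc zero)) , refl }) ]′ (onlyB k (sym B≡C))
    ... | no A≢C | no B≢C = ⊥-elim (no-fifth-class (k , A≢C , B≢C))

  second-pair : ∀ {i₁ i₂} → i₁ ≢ i₂ → d i₂ ≡ d i₁ → (∀ x → d x ≡ d i₁ → x ≡ i₁ ⊎ x ≡ i₂) → Triple d ⊎ TwoTwoOne d
  second-pair {i₁} {i₂} i₁≢i₂ di onlyA with collision (d ∘ punchIn i₁) (d≢𝟎 ∘ punchIn i₁) ℕP.≤-refl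
  ... | p , q , p≢q , dj =
    [ inj₁ , inj₂ ∘ two-pairs⇒TwoTwoOne i₁≢i₂ j₁≢j₂ di dj dA≢dB onlyA ]′ (pair-or-triple d j₁≢j₂ dj)
    where
    j₁≢j₂ : punchIn i₁ p ≢ punchIn i₁ q
    j₁≢j₂ = p≢q ∘ FinP.punchIn-injective i₁ p q
    is-i₂ : ∀ r → d (punchIn i₁ r) ≡ d i₁ → punchIn i₁ r ≡ i₂
    is-i₂ r e = [ ⊥-elim ∘ FinP.punchInᵢ≢i i₁ r , id ]′ (onlyA (punchIn i₁ r) e)
    dA≢dB : d i₁ ≢ d (punchIn i₁ p)
    dA≢dB A≡B = j₁≢j₂ (trans (is-i₂ p (sym A≡B)) (sym (is-i₂ q (trans dj (sym A≡B)))))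

  partition : Triple d ⊎ TwoTwoOne d
  partition with collision d d≢𝟎 (ℕP.m≤n+m 4 1)
  ... | i₁ , i₂ , i₁≢i₂ , di = [ inj₁ , second-pair i₁≢i₂ di ]′ (pair-or-triple d i₁≢i₂ di)

-- Descent inside a convex hull

det : ℤ² → ℤ² → ℤ
det (x , y) (x' , y') = x * y' - y * x'

⊕-assoc : ∀ p q r → p ⊕ q ⊕ r ≡ p ⊕ (q ⊕ r)
⊕-assoc (x , y) (x' , y') (x'' , y'') = cong₂ _,_ (ℤP.+-assoc x x' x'') (ℤP.+-assoc y y' y'')

⊕-identityʳ : ∀ p → p ⊕ (0ℤ , 0ℤ) ≡ p
⊕-identityʳ (x , y) = cong₂ _,_ (ℤP.+-identityʳ x) (ℤP.+-identityʳ y)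

midpoint : ∀ a u → Mean 1 1 a (a ⊕ (u ⊕ u)) (a ⊕ u)
midpoint (ax , ay) (ux , uy) = mean (halve ax ux) (halve ay uy)
  where
  halve : ∀ a u → (+ 1 + + 1) * (a + u) ≡ + 1 * a + + 1 * (a + (u + u))
  halve = solve-∀

midpoint-of-far-side : ∀ a u w → Mean 1 1 (a ⊕ (u ⊕ u)) (a ⊕ (w ⊕ w)) (a ⊕ u ⊕ w)
midpoint-of-far-side (ax , ay) (ux , uy) (wx , wy) = mean (halve ax ux wx) (halve ay uy wy)
  where
  halve : ∀ a u w → (+ 1 + + 1) * (a + u + w) ≡ + 1 * (a + (u + u)) + + 1 * (a + (w + w))
  halve = solve-∀

cross-double-steps : ∀ a u w → cross a (a ⊕ (u ⊕ u)) (a ⊕ (w ⊕ w)) ≡ (det u w + det u w) + (det u w + det u w)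
cross-double-steps (ax , ay) (ux , uy) (wx , wy) = expand ax ay ux uy wx wy
  where
  expand : ∀ ax ay ux uy wx wy →
    (ax + (ux + ux) - ax) * (ay + (wy + wy) - ay) - (ay + (uy + uy) - ay) * (ax + (wx + wx) - ax)
    ≡ (ux * wy - uy * wx + (ux * wy - uy * wx)) + (ux * wy - uy * wx + (ux * wy - uy * wx))
  expand = solve-∀

det-doubleˡ : ∀ t w → det (t ⊕ t) w ≡ det t w + det t w
det-doubleˡ (tx , ty) (wx , wy) = expand tx ty wx wy
  where
  expand : ∀ tx ty wx wy → (tx + tx) * wy - (ty + ty) * wx ≡ tx * wy - ty * wx + (tx * wy - ty * wx)
  expand = solve-∀

det-doubleʳ : ∀ u t → det u (t ⊕ t) ≡ det u t + det u t
det-doubleʳ (ux , uy) (tx , ty) = expand ux uy tx ty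
  where
  expand : ∀ ux uy tx ty → ux * (ty + ty) - uy * (tx + tx) ≡ ux * ty - uy * tx + (ux * ty - uy * tx)
  expand = solve-∀

det-shear : ∀ u w → det u w ≡ det u (u ⊕ w)
det-shear (ux , uy) (wx , wy) = expand ux uy wx wy
  where
  expand : ∀ ux uy wx wy → ux * wy - uy * wx ≡ ux * (uy + wy) - uy * (ux + wx)
  expand = solve-∀

∣double∣ : ∀ x → ∣ x + x ∣ ≡ ∣ x ∣ ℕ.+ ∣ x ∣
∣double∣ x = trans (cong ∣_∣ (sym (twice x))) (trans (ℤP.abs-* (+ 2) x) (cong (∣ x ∣ ℕ.+_) (ℕP.+-identityʳ ∣ x ∣)))
  where
  twice : ∀ x → + 2 * x ≡ x + x
  twice = solve-∀

half-≤ : ∀ {m k} → m ≢ 0 → m ℕ.+ m ℕ.≤ suc k → m ℕ.≤ k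
half-≤ {zero}  m≢0 _           = ⊥-elim (m≢0 refl)
half-≤ {suc m} _   (ℕ.s≤s 2m≤k) = ℕP.≤-trans (ℕP.m≤n+m (suc m) m) 2m≤k

norm₁ : ℤ² → ℕ
norm₁ (x , y) = ∣ x ∣ ℕ.+ ∣ y ∣

norm₁-double : ∀ t → norm₁ (t ⊕ t) ≡ norm₁ t ℕ.+ norm₁ t
norm₁-double (x , y) = trans (cong₂ ℕ._+_ (∣double∣ x) (∣double∣ y)) (swap-middle ∣ x ∣ ∣ y ∣)
  where
  swap-middle : ∀ a b → a ℕ.+ a ℕ.+ (b ℕ.+ b) ≡ a ℕ.+ b ℕ.+ (a ℕ.+ b)
  swap-middle = ℕ-solve-∀

norm₁≡0 : ∀ t → norm₁ t ≡ 0 → t ≡ (0ℤ , 0ℤ)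
norm₁≡0 (x , y) e = cong₂ _,_ (ℤP.∣i∣≡0⇒i≡0 (ℕP.m+n≡0⇒m≡0 ∣ x ∣ e)) (ℤP.∣i∣≡0⇒i≡0 (ℕP.m+n≡0⇒n≡0 ∣ x ∣ e))

module _ {n : ℕ} (v : Fin n → ℤ²) {Z : Fin n → Set} where

  private
    H = InHullWithout n v Z

  EvenPointIn : Set
  EvenPointIn = Σ ℤ² λ p → In2Z2 p × H p

  even-point : ∀ {p} → H p → class p ≡ 𝟎 → EvenPointIn
  even-point {p} p∈H p∈𝟎 = p , double⇒In2Z2 (proj₁ half) (proj₂ half) , p∈H
    where half = class≡𝟎⇒double p p∈𝟎

  -- Either a corner of the medial parallelogram a, a + u, a + w, a + u + w is even,
  -- or some side vector is, which halves the triangle.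
  triangle-descent : ∀ k a u w → H a → H (a ⊕ (u ⊕ u)) → H (a ⊕ (w ⊕ w)) →
    det u w ≢ 0ℤ → ∣ det u w ∣ ℕ.≤ k → EvenPointIn
  triangle-descent zero    a u w _  _  _  D≢0 D≤0 = ⊥-elim (D≢0 (ℤP.∣i∣≡0⇒i≡0 (ℕP.n≤0⇒n≡0 D≤0)))
  triangle-descent (suc k) a u w ha hb hc D≢0 D≤k =
    [ even-corner , even-side ]′ (corner-or-side-even (class a) (class u) (class w))
    where
    hab : H (a ⊕ u)
    hab = hullWithout-mean v 0 1 ha hb (midpoint a u)
    hac : H (a ⊕ w)
    hac = hullWithout-mean v 0 1 ha hc (midpoint a w)
    hbc : H (a ⊕ u ⊕ w)
    hbc = hullWithout-mean v 0 1 hb hc (midpoint-of-far-side a u w)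
    even-corner : class a ≡ 𝟎 ⊎ class a ⊞ class u ≡ 𝟎 ⊎ class a ⊞ class w ≡ 𝟎 ⊎ class a ⊞ class u ⊞ class w ≡ 𝟎 →
      EvenPointIn
    even-corner (inj₁ e)                = even-point ha e
    even-corner (inj₂ (inj₁ e))         = even-point hab (trans (class-⊕ a u) e)
    even-corner (inj₂ (inj₂ (inj₁ e)))  = even-point hac (trans (class-⊕ a w) e)
    even-corner (inj₂ (inj₂ (inj₂ e)))  =
      even-point hbc (trans (class-⊕ (a ⊕ u) w) (trans (cong (_⊞ class w) (class-⊕ a u)) e))
    descend : ∀ u' w' → H (a ⊕ (u' ⊕ u')) → H (a ⊕ (w' ⊕ w')) → det u w ≡ det u' w' + det u' w' → EvenPointIn
    descend u' w' hb' hc' D≡ = triangle-descent k a u' w' ha hb' hc' D'≢0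
      (half-≤ (D'≢0 ∘ ℤP.∣i∣≡0⇒i≡0) (subst (ℕ._≤ suc k) (trans (cong ∣_∣ D≡) (∣double∣ (det u' w'))) D≤k))
      where
      D'≢0 : det u' w' ≢ 0ℤ
      D'≢0 e = D≢0 (trans D≡ (cong₂ _+_ e e))
    even-side : class u ≡ 𝟎 ⊎ class w ≡ 𝟎 ⊎ class u ⊞ class w ≡ 𝟎 → EvenPointIn
    even-side (inj₁ e) with class≡𝟎⇒double u e
    ... | t , refl = descend t w hab hc (det-doubleˡ t w)
    even-side (inj₂ (inj₁ e)) with class≡𝟎⇒double w e
    ... | t , refl = descend u t hb hac (det-doubleʳ u t)
    even-side (inj₂ (inj₂ e)) with class≡𝟎⇒double (u ⊕ w) (trans (class-⊕ u w) e)
    ... | t , u⊕w≡t⊕t = descend u t hb (subst H (trans (⊕-assoc a u w) (cong (a ⊕_) u⊕w≡t⊕t)) hbc)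
      (trans (det-shear u w) (trans (cong (det u) u⊕w≡t⊕t) (det-doubleʳ u t)))

  triangle⇒even-point : ∀ {a b c} → H a → H b → H c → class a ≡ class b → class a ≡ class c → cross a b c ≢ 0ℤ → EvenPointIn
  triangle⇒even-point {a} {b} {c} ha hb hc a∼b a∼c abc≢0 =
    triangle-descent ∣ det u w ∣ a u w ha (subst H b≡ hb) (subst H c≡ hc) D≢0 ℕP.≤-refl
    where
    u = proj₁ (same-class⇒even-offset a b a∼b)
    b≡ = proj₂ (same-class⇒even-offset a b a∼b)
    w = proj₁ (same-class⇒even-offset a c a∼c)
    c≡ = proj₂ (same-class⇒even-offset a c a∼c)
    D≢0 : det u w ≢ 0ℤ
    D≢0 e = abc≢0 (trans (cong₂ (cross a) b≡ c≡) (trans (cross-double-steps a u w) (cong (λ d → d + d + (d + d)) e)))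

  ClassChange : ℤ² → ℤ² → Set
  ClassChange a b = Σ ℤ² λ r → H r × Between a b r × class r ≢ class a

  segment-descent : ∀ k a u → H a → H (a ⊕ (u ⊕ u)) → u ≢ (0ℤ , 0ℤ) → norm₁ u ℕ.≤ k → ClassChange a (a ⊕ (u ⊕ u))
  segment-descent zero    a u _  _  u≢0 u≤0 = ⊥-elim (u≢0 (norm₁≡0 u (ℕP.n≤0⇒n≡0 u≤0)))
  segment-descent (suc k) a u ha hb u≢0 u≤k = from-midpoint (class (a ⊕ u) ≟ᶜ class a)
    where
    hm : H (a ⊕ u)
    hm = hullWithout-mean v 0 1 ha hb (midpoint a u)
    m∈ab : Between a (a ⊕ (u ⊕ u)) (a ⊕ u)
    m∈ab = midpoint-between (midpoint a u)
    from-midpoint : Dec (class (a ⊕ u) ≡ class a) → ClassChange a (a ⊕ (u ⊕ u))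
    from-midpoint (no m≁a) = a ⊕ u , hm , m∈ab , m≁a
    from-midpoint (yes m∼a) = shrink (segment-descent k a t ha (subst H m≡ hm) t≢0 t≤k)
      where
      half = class≡𝟎⇒double u (⊞-cancelˡ (class a) (class u) (trans (sym (class-⊕ a u)) m∼a))
      t = proj₁ half
      m≡ : a ⊕ u ≡ a ⊕ (t ⊕ t)
      m≡ = cong (a ⊕_) (proj₂ half)
      t≢0 : t ≢ (0ℤ , 0ℤ)
      t≢0 t≡0 = u≢0 (trans (proj₂ half) (cong (λ t → t ⊕ t) t≡0))
      t≤k : norm₁ t ℕ.≤ k
      t≤k = half-≤ (t≢0 ∘ norm₁≡0 t) (subst (ℕ._≤ suc k) (trans (cong norm₁ (proj₂ half)) (norm₁-double t)) u≤k)
      shrink : ClassChange a (a ⊕ (t ⊕ t)) → ClassChange a (a ⊕ (u ⊕ u))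
      shrink (r , hr , r∈am , r≁a) = r , hr , between-transˡ (subst (λ m → Between a m r) (sym m≡) r∈am) m∈ab , r≁a

  segment⇒class-change : ∀ {a b} → H a → H b → class a ≡ class b → a ≢ b → ClassChange a b
  segment⇒class-change {a} {b} ha hb a∼b a≢b = widen (segment-descent (norm₁ u) a u ha (subst H b≡ hb) u≢0 ℕP.≤-refl)
    where
    u = proj₁ (same-class⇒even-offset a b a∼b)
    b≡ = proj₂ (same-class⇒even-offset a b a∼b)
    u≢0 : u ≢ (0ℤ , 0ℤ)
    u≢0 u≡0 = a≢b (sym (trans b≡ (trans (cong (λ t → a ⊕ (t ⊕ t)) u≡0) (⊕-identityʳ a))))
    widen : ClassChange a (a ⊕ (u ⊕ u)) → ClassChange a b
    widen (r , hr , r∈ab , r≁a) = r , hr , subst (λ b → Between a b r) (sym b≡) r∈ab , r≁a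

same-class⇒midpoint : ∀ {a b} → class a ≡ class b → Σ ℤ² (Mean 1 1 a b)
same-class⇒midpoint {a} {b} a∼b = a ⊕ u , subst (λ b → Mean 1 1 a b (a ⊕ u)) (sym b≡) (midpoint a u)
  where
  u = proj₁ (same-class⇒even-offset a b a∼b)
  b≡ = proj₂ (same-class⇒even-offset a b a∼b)

-- Pentagons

module Pentagon (v : Fin 5 → ℤ²) (v-injective : Injective _≡_ _≡_ v) (vertex : ∀ i → IsVertex 5 v i) where

  Goal : Set
  Goal = Σ ℤ² λ p → In2Z2 p × InHull 5 v p

  Avoiding : (Fin 5 → Set) → ℤ² → Set
  Avoiding = InHullWithout 5 v

  ∅ : Fin 5 → Set
  ∅ _ = ⊥

  ⁅_⁆ : Fin 5 → Fin 5 → Set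
  ⁅ i ⁆ j = j ≡ i

  ⟨_,_⟩ : Fin 5 → Fin 5 → Fin 5 → Set
  ⟨ i , j ⟩ k = k ≡ i ⊎ k ≡ j

  Hull : ℤ² → Set
  Hull = Avoiding ∅

  forget : ∀ {Z p} → Avoiding Z p → Hull p
  forget (w , _ , p∈) = w , (λ _ ()) , p∈

  avoiding-mono : ∀ {Z Z' p} → (∀ i → Z' i → Z i) → Avoiding Z p → Avoiding Z' p
  avoiding-mono Z'⊆Z (w , avoids , p∈) = w , (λ i → avoids i ∘ Z'⊆Z i) , p∈

  to-goal : ∀ {Z} → EvenPointIn v {Z} → Goal
  to-goal (p , p∈2ℤ² , w , _ , p∈) = p , p∈2ℤ² , w , p∈

  found : ∀ {Z p} → Avoiding Z p → class p ≡ 𝟎 → Goal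
  found hp p∈𝟎 = to-goal (even-point v hp p∈𝟎)

  triangle : ∀ {a b c} → Hull a → Hull b → Hull c → class a ≡ class b → class a ≡ class c → cross a b c ≢ 0ℤ → Goal
  triangle ha hb hc a∼b a∼c abc≢0 = to-goal (triangle⇒even-point v ha hb hc a∼b a∼c abc≢0)

  corner : ∀ {Z} j → ¬ Z j → Avoiding Z (v j)
  corner = vertex∈hullWithout v

  hull-corner : ∀ j → Hull (v j)
  hull-corner j = corner j λ ()

  corner-not-avoiding : ∀ i → ¬ Avoiding ⁅ i ⁆ (v i)
  corner-not-avoiding i (w , avoids , v∈) = vertex i (w , avoids i refl , v∈)

  corner-not-between : ∀ {i p q} → Avoiding ⁅ i ⁆ p → Avoiding ⁅ i ⁆ q → ¬ Between p q (v i)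
  corner-not-between {i} hp hq (α , β , v∈) = corner-not-avoiding i (hullWithout-mean v α (suc β) hp hq v∈)

  midpoint-avoiding : ∀ {Z i j m} → ¬ Z i → ¬ Z j → Mean 1 1 (v i) (v j) m → Avoiding Z m
  midpoint-avoiding i∉Z j∉Z m∈ = hullWithout-mean v 0 1 (corner _ i∉Z) (corner _ j∉Z) m∈

  between-corners : ∀ {j k p} → j ≢ k → Avoiding ⟨ j , k ⟩ p → cross (v j) (v k) p ≡ 0ℤ → Between (v j) (v k) p
  between-corners {j} {k} {p} j≢k hp p∈jk = from-position (collinear-position {v j} {v k} {p} (j≢k ∘ v-injective) p∈jk)
    where
    from-position : LinePosition (v j) (v k) p → Between (v j) (v k) p
    from-position (at-start p≡j) = ⊥-elim (corner-not-avoiding j (subst (Avoiding ⁅ j ⁆) p≡j (avoiding-mono (λ _ → inj₁) hp)))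
    from-position (at-end p≡k)   = ⊥-elim (corner-not-avoiding k (subst (Avoiding ⁅ k ⁆) p≡k (avoiding-mono (λ _ → inj₂) hp)))
    from-position (inside p∈)    = p∈
    from-position (before j∈)    = ⊥-elim (corner-not-between (avoiding-mono (λ _ → inj₁) hp) (corner k (j≢k ∘ sym)) j∈)
    from-position (after k∈)     = ⊥-elim (corner-not-between (avoiding-mono (λ _ → inj₂) hp) (corner j j≢k) k∈)

  corners-not-collinear : ∀ {i j k} → i ≢ j → i ≢ k → j ≢ k → cross (v i) (v j) (v k) ≢ 0ℤ
  corners-not-collinear {i} {j} {k} i≢j i≢k j≢k ijk≡0 =
    corner-not-between (corner j (i≢j ∘ sym)) (corner k (i≢k ∘ sym))
      (between-corners j≢k (corner i [ i≢j , i≢k ]′) (trans (sym (cross-rotate (v i) (v j) (v k))) ijk≡0))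

  OfClass : Class → Fin 5 → Set
  OfClass c i = class (v i) ≡ c

  distinct-classes : ∀ {i j} → class (v i) ≢ class (v j) → i ≢ j
  distinct-classes ci≢cj refl = ci≢cj refl

  module Configuration (cfg : TwoTwoOne (class ∘ v)) (odd-corners : ∀ i → class (v i) ≢ 𝟎) where
    open TwoTwoOne cfg public

    A B C : Class
    A = class (v x₁)
    B = class (v y₁)
    C = class (v z)

    by-class : ∀ {P : Set} q → (class q ≡ 𝟎 → P) → (class q ≡ A → P) → (class q ≡ B → P) → (class q ≡ C → P) → P
    by-class q of-𝟎 of-A of-B of-C = [ of-𝟎 , [ of-A , [ of-B , of-C ]′ ]′ ]′
      (classes-exhaust A B C (odd-corners x₁) (odd-corners y₁) (odd-corners z) dx≢dy dx≢dz dy≢dz (class q))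

    x₁≢x₂ᵥ : v x₁ ≢ v x₂
    x₁≢x₂ᵥ = x₁≢x₂ ∘ v-injective

    x₂∉B : class (v x₂) ≢ B
    x₂∉B = dx≢dy ∘ trans (sym dx₂≡dx₁)

    x₂∉C : class (v x₂) ≢ C
    x₂∉C = dx≢dz ∘ trans (sym dx₂≡dx₁)

    X-avoids-z : cross (v z) (v x₁) (v x₂) ≢ 0ℤ
    X-avoids-z = corners-not-collinear (distinct-classes (dx≢dz ∘ sym)) (distinct-classes (x₂∉C ∘ sym)) x₁≢x₂

    X-avoids-y₁ : cross (v x₁) (v x₂) (v y₁) ≢ 0ℤ
    X-avoids-y₁ = corners-not-collinear x₁≢x₂ (distinct-classes dx≢dy) (distinct-classes x₂∉B)

    X-avoids-y₂ : cross (v x₁) (v x₂) (v y₂) ≢ 0ℤ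
    X-avoids-y₂ = corners-not-collinear x₁≢x₂ (distinct-classes (dx≢dy ∘ flip trans dy₂≡dy₁))
      (distinct-classes (x₂∉B ∘ flip trans dy₂≡dy₁))

    Side : ℤ² → ℤ² → Set
    Side p q = Between (v x₁) p q ⊎ Between p (v x₂) q

    side⇒between : ∀ {p q} → Between (v x₁) (v x₂) p → Side p q → Between (v x₁) (v x₂) q
    side⇒between p∈X = [ flip between-transˡ p∈X , flip between-transʳ p∈X ]′

    -- Both halves of x₁x₂ contain a point leaving the class A; two such points of class C
    -- span a triangle with z.
    split-at : ∀ {Z p} → ¬ Z x₁ → ¬ Z x₂ → Avoiding Z p → class p ≡ A → Between (v x₁) (v x₂) p →
      (∀ {q} → Avoiding Z q → class q ≡ B → Side p q → Goal) → Goal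
    split-at {Z} {p} x₁∉Z x₂∉Z hp p∈A p∈X handle =
      from-left (segment⇒class-change v (corner x₁ x₁∉Z) hp (sym p∈A) (between-≢ˡ p∈X x₁≢x₂ᵥ ∘ sym))
                (segment⇒class-change v hp (corner x₂ x₂∉Z) (trans p∈A (sym dx₂≡dx₁)) (between-≢ʳ p∈X x₁≢x₂ᵥ))
      where
      from-right : ∀ {q₁} → Avoiding Z q₁ → Between (v x₁) p q₁ → class q₁ ≡ C → ClassChange v p (v x₂) → Goal
      from-right h₁ q₁∈ q₁∈C (q₂ , h₂ , q₂∈ , q₂≁p) = by-class q₂ (found h₂)
        (λ q₂∈A → ⊥-elim (q₂≁p (trans q₂∈A (sym p∈A))))
        (λ q₂∈B → handle h₂ q₂∈B (inj₂ q₂∈))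
        (λ q₂∈C → triangle (hull-corner z) (forget h₁) (forget h₂) (sym q₁∈C) (sym q₂∈C)
                            (cross-separated-≢0 (v z) q₁∈ q₂∈ p∈X X-avoids-z))
      from-left : ClassChange v (v x₁) p → ClassChange v p (v x₂) → Goal
      from-left (q₁ , h₁ , q₁∈ , q₁≁A) right = by-class q₁ (found h₁) (⊥-elim ∘ q₁≁A)
        (λ q₁∈B → handle h₁ q₁∈B (inj₁ q₁∈))
        (λ q₁∈C → from-right h₁ q₁∈ q₁∈C right)

  module OnX (cfg : TwoTwoOne (class ∘ v)) (odd-corners : ∀ i → class (v i) ≢ 𝟎) where
    open Configuration cfg odd-corners
    private module Swapped = Configuration (swap-pairs cfg) odd-corners

    of-class-B-on-X : ∀ {p} → Avoiding (OfClass B) p → class p ≡ B → Between (v x₁) (v x₂) p → Goal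
    of-class-B-on-X {p} hp p∈B p∈X = on-Y? (cross (v y₁) (v y₂) p ℤ.≟ 0ℤ)
      where
      off-X : ∀ {q} → Swapped.Side p q → cross (v x₁) (v x₂) q ≢ 0ℤ
      off-X (inj₁ q∈) = cross-between-≢0 (v x₁) (v x₂) q∈ X-avoids-y₁ (between-collinear p∈X)
      off-X (inj₂ q∈) = cross-between-≢0 (v x₁) (v x₂) (between-sym q∈) X-avoids-y₂ (between-collinear p∈X)
      on-Y? : Dec (cross (v y₁) (v y₂) p ≡ 0ℤ) → Goal
      on-Y? (no p∉Y) = triangle (hull-corner y₁) (hull-corner y₂) (forget hp) (sym dy₂≡dy₁) (sym p∈B) p∉Y
      on-Y? (yes p-on-Y) = Swapped.split-at (λ ()) (λ ()) (forget hp) p∈B p∈Y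
        λ hq q∈A side → triangle (hull-corner x₁) (hull-corner x₂) (forget hq) (sym dx₂≡dx₁) (sym q∈A) (off-X side)
        where
        p∈Y : Between (v y₁) (v y₂) p
        p∈Y = between-corners y₁≢y₂ (avoiding-mono (λ _ → [ (λ { refl → refl }) , (λ { refl → dy₂≡dy₁ }) ]′) hp) p-on-Y

    midpoints-on-X : ∀ {m n} → Mean 1 1 (v x₁) (v x₂) m → Mean 1 1 (v y₁) (v y₂) n →
      class m ≡ C → class n ≡ C → cross (v x₁) (v x₂) n ≡ 0ℤ → Goal
    midpoints-on-X {m} {n} m∈ n∈ m∈C n∈C n-on-X = from-weights n∈X
      where
      hm : Avoiding (OfClass C) m
      hm = midpoint-avoiding dx≢dz x₂∉C m∈
      hn : Avoiding (OfClass A) n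
      hn = midpoint-avoiding (dx≢dy ∘ sym) (dx≢dy ∘ sym ∘ trans (sym dy₂≡dy₁)) n∈
      n∈X : Between (v x₁) (v x₂) n
      n∈X = between-corners x₁≢x₂ (avoiding-mono (λ _ → [ (λ { refl → refl }) , (λ { refl → dx₂≡dx₁ }) ]′) hn) n-on-X
      z≢m : v z ≢ m
      z≢m z≡m = corner-not-avoiding z (subst (Avoiding ⁅ z ⁆) (sym z≡m) (avoiding-mono (λ { _ refl → refl }) hm))
      through-z : m ≡ n → ClassChange v (v z) m → Goal
      through-z m≡n (q , hq , q∈zm , q≁C) = by-class q (found hq)
        (λ q∈A → triangle (hull-corner x₁) (hull-corner x₂) hq (sym dx₂≡dx₁) (sym q∈A)
          (cross-between-≢0 (v x₁) (v x₂) q∈zm (X-avoids-z ∘ trans (cross-rotate (v z) (v x₁) (v x₂)))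
                             (between-collinear (midpoint-between m∈))))
        (λ q∈B → triangle (hull-corner y₁) (hull-corner y₂) hq (sym dy₂≡dy₁) (sym q∈B)
          (cross-between-≢0 (v y₁) (v y₂) q∈zm (Swapped.X-avoids-z ∘ trans (cross-rotate (v z) (v y₁) (v y₂)))
                             (subst (λ t → cross (v y₁) (v y₂) t ≡ 0ℤ) (sym m≡n) (between-collinear (midpoint-between n∈)))))
        (⊥-elim ∘ q≁C)
      from-weights : Between (v x₁) (v x₂) n → Goal
      from-weights (g , h , n∈ʷ) with g ℕ.≟ h
      ... | yes refl = through-z (midpoint-unique g m∈ n∈ʷ)
                         (segment⇒class-change v (hull-corner z) (forget hm) (sym m∈C) z≢m)
      ... | no g≢h = triangle (hull-corner z) (forget hm) (forget hn) (sym m∈C) (sym n∈C)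
                       (cross-mean₂-≢0 m∈ n∈ʷ weights-differ X-avoids-z)
        where
        weights-differ : 1 ℕ.* suc h ≢ 1 ℕ.* suc g
        weights-differ e = g≢h (sym (ℕP.suc-injective (trans (sym (ℕP.*-identityˡ (suc h))) (trans e (ℕP.*-identityˡ (suc g))))))

  module TwoTwoOneCase (cfg : TwoTwoOne (class ∘ v)) (odd-corners : ∀ i → class (v i) ≢ 𝟎) where
    open Configuration cfg odd-corners
    open OnX cfg odd-corners
    private
      module Swapped = Configuration (swap-pairs cfg) odd-corners
      module SwappedFacts = OnX (swap-pairs cfg) odd-corners

    both-midpoints-C : ∀ {m n} → Mean 1 1 (v x₁) (v x₂) m → Mean 1 1 (v y₁) (v y₂) n →
      class m ≡ C → class n ≡ C → Goal
    both-midpoints-C {m} {n} m∈ n∈ m∈C n∈C with cross (v x₁) (v x₂) n ℤ.≟ 0ℤ | cross (v y₁) (v y₂) m ℤ.≟ 0ℤ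
    ... | yes n-on-X | _         = midpoints-on-X m∈ n∈ m∈C n∈C n-on-X
    ... | no _       | yes m-on-Y = SwappedFacts.midpoints-on-X n∈ m∈ n∈C m∈C m-on-Y
    ... | no n∉X     | no m∉Y     = across (segment⇒class-change v hm hn (trans m∈C (sym n∈C)) m≢n)
      where
      hm = midpoint-avoiding {∅} (λ ()) (λ ()) m∈
      hn = midpoint-avoiding {∅} (λ ()) (λ ()) n∈
      m-on-X = between-collinear (midpoint-between m∈)
      n-on-Y = between-collinear (midpoint-between n∈)
      m≢n : m ≢ n
      m≢n m≡n = n∉X (subst (λ t → cross (v x₁) (v x₂) t ≡ 0ℤ) m≡n m-on-X)
      across : ClassChange v m n → Goal
      across (q , hq , q∈mn , q≁C) = by-class q (found hq)
        (λ q∈A → triangle (hull-corner x₁) (hull-corner x₂) hq (sym dx₂≡dx₁) (sym q∈A)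
          (cross-between-≢0 (v x₁) (v x₂) (between-sym q∈mn) n∉X m-on-X))
        (λ q∈B → triangle (hull-corner y₁) (hull-corner y₂) hq (sym dy₂≡dy₁) (sym q∈B)
          (cross-between-≢0 (v y₁) (v y₂) q∈mn m∉Y n-on-Y))
        (λ q∈C → ⊥-elim (q≁C (trans q∈C (sym m∈C))))

    two-two-one : Goal
    two-two-one = by-class m
      (found (midpoint-avoiding {∅} (λ ()) (λ ()) m∈))
      (λ m∈A → split-at x₁∉B x₂∉B hm m∈A m∈X λ hq q∈B side → of-class-B-on-X hq q∈B (side⇒between m∈X side))
      (λ m∈B → of-class-B-on-X hm m∈B m∈X)
      (λ m∈C → by-class n
        (found (midpoint-avoiding {∅} (λ ()) (λ ()) n∈))
        (λ n∈A → SwappedFacts.of-class-B-on-X hn n∈A n∈Y)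
        (λ n∈B → Swapped.split-at y₁∉A y₂∉A hn n∈B n∈Y
          λ hq q∈A side → SwappedFacts.of-class-B-on-X hq q∈A (Swapped.side⇒between n∈Y side))
        (both-midpoints-C m∈ n∈ m∈C))
      where
      m = proj₁ (same-class⇒midpoint (sym dx₂≡dx₁))
      m∈ = proj₂ (same-class⇒midpoint (sym dx₂≡dx₁))
      n = proj₁ (same-class⇒midpoint (sym dy₂≡dy₁))
      n∈ = proj₂ (same-class⇒midpoint (sym dy₂≡dy₁))
      m∈X = midpoint-between m∈
      n∈Y = midpoint-between n∈
      x₁∉B : class (v x₁) ≢ B
      x₁∉B = dx≢dy
      y₁∉A : class (v y₁) ≢ A
      y₁∉A = dx≢dy ∘ sym
      y₂∉A : class (v y₂) ≢ A
      y₂∉A = y₁∉A ∘ trans (sym dy₂≡dy₁)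
      hm : Avoiding (OfClass B) m
      hm = midpoint-avoiding x₁∉B x₂∉B m∈
      hn : Avoiding (OfClass A) n
      hn = midpoint-avoiding y₁∉A y₂∉A n∈

  theorem : Goal
  theorem = some-corner-even? (FinP.any? λ i → class (v i) ≟ᶜ 𝟎)
    where
    from-triple : Triple (class ∘ v) → Goal
    from-triple t = triangle (hull-corner i) (hull-corner j) (hull-corner k) (sym dj≡di) (sym dk≡di)
                             (corners-not-collinear i≢j i≢k j≢k)
      where open Triple t
    some-corner-even? : Dec (∃ λ i → class (v i) ≡ 𝟎) → Goal
    some-corner-even? (yes (i , vi∈𝟎)) = found (hull-corner i) vi∈𝟎
    some-corner-even? (no none-even) =
      [ from-triple , flip TwoTwoOneCase.two-two-one odd-corners ]′ (partition (class ∘ v) odd-corners)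
      where
      odd-corners : ∀ i → class (v i) ≢ 𝟎
      odd-corners i vi∈𝟎 = none-even (i , vi∈𝟎)

mainTheorem2 : (v : Fin 5 → ℤ²) → IsIntegerPentagon v →
    Σ ℤ² (λ p → In2Z2 p × InHull 5 v p)
-- Non-collinearity of any three vertices follows from their being extreme points.
mainTheorem2 v (v-injective , vertex , _) = Pentagon.theorem v v-injective vertex
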